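{- Let $(T_r)_{r\in\mathbb{Z}}$ be the Tribonacci sequence. Then for every non-negative integer $k$: \[ 8\sum_{j=0}^k (-1)^j T_{2j}^2 = (-1)^k\left(7T_{2k}^2 + 3T_{2k-1}^2 - 6T_{2k-2}^2 - T_{2k-4}^2 + T_{2k-5}^2\right) + 2 . \]
   Context: The Tribonacci sequence $(T_r)_{r\in\mathbb{Z}}$ is defined by $T_0=0$, $T_1=1$, $T_2=1$ and $T_r=T_{r-1}+T_{r-2}+T_{r-3}$ for all integers $r$ (this determines $T_r$ for negative $r$ as well). -}

module Defs where

open import Data.Nat using (ℕ; zero; suc)
open import Data.Integer using (ℤ; +_; -[1+_]; _+_; _-_; _*_; -_)
open import Data.Product using (_×_; _,_; proj₁)

-- Forward triples: tribF n = (T_n , T_{n+1} , T_{n+2}) for n ≥ 0.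
tribF : ℕ → ℤ × ℤ × ℤ
tribF zero = (+ 0 , + 1 , + 1)
tribF (suc n) with tribF n
... | (a , b , c) = (b , c , a + b + c)

-- Backward triples: tribB n = (T_{-n} , T_{-n+1} , T_{-n+2}) for n ≥ 0,
-- using T_{r-3} = T_r - T_{r-1} - T_{r-2}.
tribB : ℕ → ℤ × ℤ × ℤ
tribB zero = (+ 0 , + 1 , + 1)
tribB (suc n) with tribB n
... | (a , b , c) = (c - b - a , a , b)

T : ℤ → ℤ
T (+ n)      = proj₁ (tribF n)
T -[1+ n ]   = proj₁ (tribB (suc n))

sgn : ℕ → ℤ
sgn zero = + 1
sgn (suc k) = - sgn k

sumTo : ℕ → (ℕ → ℤ) → ℤ
sumTo zero f = f zero
sumTo (suc k) f = sumTo k f + f (suc k)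

sq : ℤ → ℤ
sq x = x * x

module Submission where

-- Let E(n) = 7 T(n)² + 3 T(n-1)² − 6 T(n-2)² − T(n-4)² + T(n-5)².  Expressing
-- T(n-5), …, T(n+2) through the three values T(n-5), T(n-4), T(n-3) shows that
-- E(n+2) + E(n) = 8 T(n+2)² for every integer n.  Hence the sign-alternating
-- sums telescope: if 8 S_k = (-1)^k E(2k) + 2, then
-- 8 S_{k+1} = (-1)^k (E(2k) − 8 T(2k+2)²) + 2 = (-1)^{k+1} E(2k+2) + 2.

open import Defs
open import Data.Nat using (ℕ; zero; suc)
import Data.Nat as ℕ
import Data.Nat.Properties as ℕ
open import Data.Integer using (ℤ; +_; -[1+_]; _+_; _-_; _*_; -_)
open import Data.Integer.Properties using (+-assoc)
open import Data.Integer.Tactic.RingSolver using (solve-∀)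
open import Data.Product using (proj₁; proj₂)
open import Relation.Binary.PropositionalEquality
  using (_≡_; refl; sym; cong; cong₂; trans; module ≡-Reasoning)
open ≡-Reasoning

IsTribonacci : (ℕ → ℤ) → Set
IsTribonacci x = ∀ i → x (i ℕ.+ 3) ≡ x i + x (i ℕ.+ 1) + x (i ℕ.+ 2)

bracket : ℤ → ℤ → ℤ → ℤ → ℤ → ℤ
bracket a b c d e = + 7 * sq a + + 3 * sq b - + 6 * sq c - sq d + sq e

bracket-cong : ∀ {a a′ b b′ c c′ d d′ e e′} →
               a ≡ a′ → b ≡ b′ → c ≡ c′ → d ≡ d′ → e ≡ e′ →
               bracket a b c d e ≡ bracket a′ b′ c′ d′ e′
bracket-cong refl refl refl refl refl = refl

window : (ℕ → ℤ) → ℤ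
window x = bracket (x 5) (x 4) (x 3) (x 1) (x 0)

window-cong : ∀ {x y : ℕ → ℤ} → (∀ i → x i ≡ y i) → window x ≡ window y
window-cong x≗y = bracket-cong (x≗y 5) (x≗y 4) (x≗y 3) (x≗y 1) (x≗y 0)

bracket-identity : ∀ a b c →
  let d = a + b + c; e = b + c + d; f = c + d + e; g = d + e + f; h = e + f + g in
  (+ 7 * (h * h) + + 3 * (g * g) - + 6 * (f * f) - d * d + c * c)
    + (+ 7 * (f * f) + + 3 * (e * e) - + 6 * (d * d) - b * b + a * a)
  ≡ + 8 * (h * h)
bracket-identity = solve-∀

window-+2 : ∀ {x} → IsTribonacci x →
            window (λ i → x (2 ℕ.+ i)) + window x ≡ + 8 * sq (x 7)
window-+2 {x} rec rewrite rec 4 | rec 3 | rec 2 | rec 1 | rec 0 =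
  bracket-identity (x 0) (x 1) (x 2)

-- Three backward steps of tribB from (a , b , c), read forwards.
backward-identity : ∀ a b c →
  let d = c - b - a; e = b - a - d in a ≡ (a - d - e) + e + d
backward-identity = solve-∀

T-recurrence : ∀ r → T (r + + 3) ≡ T r + T (r + + 1) + T (r + + 2)
T-recurrence (+ n) rewrite ℕ.+-comm n 3 | ℕ.+-comm n 1 | ℕ.+-comm n 2 = refl
T-recurrence -[1+ 0 ] = refl
T-recurrence -[1+ 1 ] = refl
T-recurrence -[1+ 2 ] = refl
T-recurrence -[1+ suc (suc (suc m)) ] =
  backward-identity (proj₁ t) (proj₁ (proj₂ t)) (proj₂ (proj₂ t))
  where t = tribB (suc m)

T-from : ℤ → ℕ → ℤ
T-from r i = T (r + + i)

T-from-isTribonacci : ∀ r → IsTribonacci (T-from r)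
T-from-isTribonacci r i = begin
  T (r + + (i ℕ.+ 3))                                 ≡⟨ cong T (+-assoc r (+ i) (+ 3)) ⟨
  T (r + + i + + 3)                                   ≡⟨ T-recurrence (r + + i) ⟩
  T (r + + i) + T (r + + i + + 1) + T (r + + i + + 2) ≡⟨ cong₂ (λ u v → T (r + + i) + T u + T v)
                                                           (+-assoc r (+ i) (+ 1)) (+-assoc r (+ i) (+ 2)) ⟩
  T (r + + i) + T (r + + (i ℕ.+ 1)) + T (r + + (i ℕ.+ 2)) ∎

bracketAt : ℤ → ℤ
bracketAt n = bracket (T n) (T (n - + 1)) (T (n - + 2)) (T (n - + 4)) (T (n - + 5))

bracketAt≡window : ∀ n → bracketAt n ≡ window (T-from (n - + 5))
bracketAt≡window n = bracket-cong
  (cong T (add-sub n (+ 5)))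
  (cong T (sub-sub n (+ 5) (+ 4))) (cong T (sub-sub n (+ 5) (+ 3)))
  (cong T (sub-sub n (+ 5) (+ 1))) (cong T (sub-sub n (+ 5) (+ 0)))
  where
  add-sub : ∀ n m → n ≡ n - m + m
  add-sub = solve-∀
  sub-sub : ∀ n m p → n - (m - p) ≡ n - m + p
  sub-sub = solve-∀

bracketAt-+2 : ∀ n → bracketAt (n + + 2) + bracketAt n ≡ + 8 * sq (T (n + + 2))
bracketAt-+2 n = begin
  bracketAt (n + + 2) + bracketAt n
    ≡⟨ cong₂ _+_ (trans (bracketAt≡window (n + + 2)) (window-cong shift)) (bracketAt≡window n) ⟩
  window (λ i → x (2 ℕ.+ i)) + window x
    ≡⟨ window-+2 {x} (T-from-isTribonacci (n - + 5)) ⟩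
  + 8 * sq (x 7)
    ≡⟨ cong (λ m → + 8 * sq (T m)) (n+2≡n-5+7 n) ⟨
  + 8 * sq (T (n + + 2)) ∎
  where
  x = T-from (n - + 5)
  reassoc : ∀ n j → n + + 2 - + 5 + j ≡ n - + 5 + (+ 2 + j)
  reassoc = solve-∀
  shift : ∀ i → T-from (n + + 2 - + 5) i ≡ x (2 ℕ.+ i)
  shift i = cong T (reassoc n (+ i))
  n+2≡n-5+7 : ∀ n → n + + 2 ≡ n - + 5 + + 7
  n+2≡n-5+7 = solve-∀

alternating-step : ∀ S s E E′ q → + 8 * S ≡ s * E + + 2 → E′ + E ≡ + 8 * q →
                   + 8 * (S + - s * q) ≡ - s * E′ + + 2
alternating-step S s E E′ q hyp step = begin
  + 8 * (S + - s * q)             ≡⟨ distrib S s q ⟩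
  + 8 * S + - s * (+ 8 * q)       ≡⟨ cong₂ (λ u v → u + - s * v) hyp (sym step) ⟩
  s * E + + 2 + - s * (E′ + E)    ≡⟨ cancel s E E′ ⟩
  - s * E′ + + 2                  ∎
  where
  distrib : ∀ S s q → + 8 * (S + - s * q) ≡ + 8 * S + - s * (+ 8 * q)
  distrib = solve-∀
  cancel : ∀ s E E′ → s * E + + 2 + - s * (E′ + E) ≡ - s * E′ + + 2
  cancel = solve-∀

double-suc : ∀ k → + (2 ℕ.* suc k) ≡ + (2 ℕ.* k) + + 2
double-suc k = cong +_ (trans (ℕ.*-suc 2 k) (ℕ.+-comm 2 (2 ℕ.* k)))

mainTheorem7 : (k : ℕ) →
    + 8 * sumTo k (λ j → sgn j * sq (T (+ (2 Data.Nat.* j))))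
      ≡ sgn k * ( + 7 * sq (T (+ (2 Data.Nat.* k)))
                + + 3 * sq (T (+ (2 Data.Nat.* k) - + 1))
                - + 6 * sq (T (+ (2 Data.Nat.* k) - + 2))
                - sq (T (+ (2 Data.Nat.* k) - + 4))
                + sq (T (+ (2 Data.Nat.* k) - + 5)) )
        + + 2
mainTheorem7 zero = refl
mainTheorem7 (suc k) = begin
  + 8 * (S + - sgn k * sq (T (+ (2 ℕ.* suc k))))  ≡⟨ cong (λ m → + 8 * (S + - sgn k * sq (T m))) (double-suc k) ⟩
  + 8 * (S + - sgn k * sq (T (n + + 2)))         ≡⟨ alternating-step S (sgn k) (bracketAt n) (bracketAt (n + + 2))
                                                      (sq (T (n + + 2))) (mainTheorem7 k) (bracketAt-+2 n) ⟩
  - sgn k * bracketAt (n + + 2) + + 2            ≡⟨ cong (λ m → - sgn k * bracketAt m + + 2) (double-suc k) ⟨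
  - sgn k * bracketAt (+ (2 ℕ.* suc k)) + + 2    ∎
  where
  n = + (2 ℕ.* k)
  S = sumTo k (λ j → sgn j * sq (T (+ (2 ℕ.* j))))
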